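{- Let $X$ be a finite connected directed graph and let $\alpha$ be a constant $\mathbb{Z}_p$-valued voltage assignment on $X$. Then the graphs $X_n=X(\mathbb{Z}/p^n\mathbb{Z},\alpha_{/n})$, $n\ge 0$, with the natural projections $X_{n+1}\to X_n$, form a $\mathbb{Z}_p$-tower over $X$ if and only if the value of $\alpha$ lies in $\mathbb{Z}_p^\times$ and $\tilde X$ contains a directed cycle whose weight is coprime to $p$.
   Context: Directed graphs may have multiple edges and loops; a directed graph is connected if its underlying undirected graph is connected. For an abelian group $G$ and $\alpha:\mathbb{E}(X)\to G$, the derived graph $X(G,\alpha)$ has vertex set $\mathbb{V}(X)\times G$ and edge set $\mathbb{E}(X)\times G$, where if $e$ goes from $s$ to $t$ then $(e,\sigma)$ goes from $(s,\sigma)$ to $(t,\sigma+\alpha(e))$; it covers $X$ via $(x,\sigma)\mapsto x$. For $\alpha:\mathbb{E}(X)\to\mathbb{Z}_p$, $\alpha_{/n}$ is its composite with $\mathbb{Z}_p\to\mathbb{Z}/p^n\mathbb{Z}$, and the natural projection $X_{n+1}\to X_n$ is $(x,a)\mapsto(x,a\bmod p^n)$; $\alpha$ is constant if it takes the same value on all edges. A covering $Y\to X$ is Galois if every vertex of $X$ has exactly $d$ preimages and the group of deck transformations (automorphisms of $Y$ commuting with the projection) has order $d$; a $\mathbb{Z}_p$-tower over $X$ is a sequence of coverings $X=X_0\leftarrow X_1\leftarrow\cdots$ with each $X_n\to X$ Galois with deck group isomorphic to $\mathbb{Z}/p^n\mathbb{Z}$. $\tilde X$ is the directed graph with the same vertices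 as $X$ and with the edges of $X$ together with a reversed copy of each edge of $X$; the weight of a directed path in $\tilde X$ is the number of its edges belonging to $X$ minus the number of its reversed edges. -}

module Defs where

open import Data.Nat using (ℕ; zero; suc; _+_; _*_; _^_; _<_; NonZero)
open import Data.Nat.Properties using (m^n≢0)
open import Data.Nat.DivMod using (_mod_; _%_)
open import Data.Nat.Primality using (Prime; prime⇒nonZero)
open import Data.Fin using (Fin; toℕ; fromℕ<; inject₁; fromℕ) renaming (zero to fzero; suc to fsuc)
open import Data.Integer as ℤ using (ℤ; +_; -[1+_])
open import Data.Bool using (Bool; true; false)
open import Data.Product using (Σ; ∃; ∃-syntax; _×_; _,_; proj₁; proj₂; ∃!)
open import Data.Sum using (_⊎_)
open import Function.Bundles using (_↔_; Inverse)
open import Relation.Binary.PropositionalEquality using (_≡_)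

record Graph : Set₁ where
  field
    Vtx : Set
    Edg : Set
    src : Edg → Vtx
    tgt : Edg → Vtx
open Graph public

record FinGraph : Set where
  field
    nV  : ℕ
    nE  : ℕ
    s   : Fin nE → Fin nV
    t   : Fin nE → Fin nV
open FinGraph public

toGraph : FinGraph → Graph
toGraph X = record { Vtx = Fin (nV X) ; Edg = Fin (nE X) ; src = s X ; tgt = t X }

-- walks in the underlying undirected graph
data UWalk (X : FinGraph) : Fin (nV X) → Fin (nV X) → Set where
  here : ∀ {u} → UWalk X u u
  fwd  : ∀ {v} (e : Fin (nE X)) → UWalk X (t X e) v → UWalk X (s X e) v
  bwd  : ∀ {v} (e : Fin (nE X)) → UWalk X (s X e) v → UWalk X (t X e) v

Connected : FinGraph → Set
Connected X = ∀ u v → UWalk X u v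

-- The graph X̃: edges of X (true = original) and reversed copies (false)

Dart : FinGraph → Set
Dart X = Fin (nE X) × Bool

dsrc : (X : FinGraph) → Dart X → Fin (nV X)
dsrc X (e , true)  = s X e
dsrc X (e , false) = t X e

dtgt : (X : FinGraph) → Dart X → Fin (nV X)
dtgt X (e , true)  = t X e
dtgt X (e , false) = s X e

dweight : ∀ {X : FinGraph} → Dart X → ℤ
dweight (_ , true)  = + 1
dweight (_ , false) = -[1+ 0 ]

∑ : ∀ {k} → (Fin k → ℤ) → ℤ
∑ {zero}  f = + 0
∑ {suc k} f = f fzero ℤ.+ ∑ (λ i → f (fsuc i))

record DirCycle (X : FinGraph) : Set where
  field
    len     : ℕ
    dart    : Fin (suc len) → Dart X
    consec  : ∀ (i : Fin len) → dtgt X (dart (inject₁ i)) ≡ dsrc X (dart (fsuc i))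
    closes  : dtgt X (dart (fromℕ len)) ≡ dsrc X (dart fzero)
    simple  : ∀ i j → dsrc X (dart i) ≡ dsrc X (dart j) → i ≡ j
open DirCycle public

cycleWeight : ∀ {X} → DirCycle X → ℤ
cycleWeight {X} c = ∑ (λ i → dweight {X} (dart c i))

_+ₘ_ : ∀ {m} → Fin m → Fin m → Fin m
_+ₘ_ {suc m} a b = (toℕ a + toℕ b) mod suc m

record IsMorphism (Y X : Graph) (fV : Vtx Y → Vtx X) (fE : Edg Y → Edg X) : Set where
  field
    src-comm : ∀ e → src X (fE e) ≡ fV (src Y e)
    tgt-comm : ∀ e → tgt X (fE e) ≡ fV (tgt Y e)

record IsCovering (Y X : Graph) (fV : Vtx Y → Vtx X) (fE : Edg Y → Edg X) : Set where
  field
    morphism : IsMorphism Y X fV fE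
    out-bij  : ∀ y (e' : Edg X) → src X e' ≡ fV y →
               ∃! _≡_ (λ e → src Y e ≡ y × fE e ≡ e')
    in-bij   : ∀ y (e' : Edg X) → tgt X e' ≡ fV y →
               ∃! _≡_ (λ e → tgt Y e ≡ y × fE e ≡ e')

record Deck (Y X : Graph) (πV : Vtx Y → Vtx X) (πE : Edg Y → Edg X) : Set where
  field
    dV : Vtx Y ↔ Vtx Y
    dE : Edg Y ↔ Edg Y
    src-pres : ∀ e → src Y (Inverse.to dE e) ≡ Inverse.to dV (src Y e)
    tgt-pres : ∀ e → tgt Y (Inverse.to dE e) ≡ Inverse.to dV (tgt Y e)
    projV    : ∀ y → πV (Inverse.to dV y) ≡ πV y
    projE    : ∀ e → πE (Inverse.to dE e) ≡ πE e
open Deck public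

module _ {Y X : Graph} {πV : Vtx Y → Vtx X} {πE : Edg Y → Edg X} where

  _≈D_ : Deck Y X πV πE → Deck Y X πV πE → Set
  D ≈D D' = (∀ y → Inverse.to (dV D) y ≡ Inverse.to (dV D') y)
          × (∀ e → Inverse.to (dE D) e ≡ Inverse.to (dE D') e)

  IsComposite : Deck Y X πV πE → Deck Y X πV πE → Deck Y X πV πE → Set
  IsComposite D D₁ D₂ =
      (∀ y → Inverse.to (dV D) y ≡ Inverse.to (dV D₁) (Inverse.to (dV D₂) y))
    × (∀ e → Inverse.to (dE D) e ≡ Inverse.to (dE D₁) (Inverse.to (dE D₂) e))

  Enumerates : ∀ {d} → (Fin d → Deck Y X πV πE) → Set
  Enumerates φ = (∀ D → ∃[ i ] φ i ≈D D) × (∀ i j → φ i ≈D φ j → i ≡ j)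

  DeckOrder : ℕ → Set
  DeckOrder d = Σ (Fin d → Deck Y X πV πE) Enumerates

  DeckIsoZmod : ℕ → Set
  DeckIsoZmod m = Σ (Fin m → Deck Y X πV πE) λ φ →
    Enumerates φ × (∀ i j → IsComposite (φ (i +ₘ j)) (φ i) (φ j))

IsGalois : (Y X : Graph) (πV : Vtx Y → Vtx X) (πE : Edg Y → Edg X) → ℕ → Set
IsGalois Y X πV πE d =
    IsCovering Y X πV πE
  × (∀ x → Fin d ↔ Σ (Vtx Y) (λ y → πV y ≡ x))
  × DeckOrder {Y} {X} {πV} {πE} d

Derived : (X : FinGraph) {m : ℕ} → (Fin (nE X) → Fin m) → Graph
Derived X {m} β = record
  { Vtx = Fin (nV X) × Fin m
  ; Edg = Fin (nE X) × Fin m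
  ; src = λ { (e , σ) → (s X e , σ) }
  ; tgt = λ { (e , σ) → (t X e , σ +ₘ β e) }
  }

module _ {p : ℕ} (pr : Prime p) where
  private instance
    nzp : NonZero p
    nzp = prime⇒nonZero pr

  record ℤₚ : Set where
    field
      digit  : ℕ → ℕ
      digit< : ∀ n → digit n < p ^ n
      coh    : ∀ n → _%_ (digit (suc n)) (p ^ n) {{m^n≢0 p n}} ≡ digit n
  open ℤₚ public

  _≈ₚ_ : ℤₚ → ℤₚ → Set
  a ≈ₚ b = ∀ n → digit a n ≡ digit b n

  IsUnit : ℤₚ → Set
  IsUnit a = Σ ℤₚ λ b → ∀ n → _%_ (digit a n * digit b n) (p ^ n) {{m^n≢0 p n}} ≡ _%_ 1 (p ^ n) {{m^n≢0 p n}}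

  red : ℤₚ → (n : ℕ) → Fin (p ^ n)
  red a n = fromℕ< (digit< a n)

  IsConstant : ∀ {X : FinGraph} → (Fin (nE X) → ℤₚ) → Set
  IsConstant α = ∀ e e' → α e ≈ₚ α e'

  Layer : (X : FinGraph) → (Fin (nE X) → ℤₚ) → ℕ → Graph
  Layer X α n = Derived X (λ e → red (α e) n)

  down : ∀ n → Fin (p ^ suc n) → Fin (p ^ n)
  down n a = _mod_ (toℕ a) (p ^ n) {{m^n≢0 p n}}

  IsZpTower : (X : FinGraph) → (Fin (nE X) → ℤₚ) → Set
  IsZpTower X α = ∀ n →
      IsCovering (Layer X α (suc n)) (Layer X α n)
                 (λ { (x , a) → (x , down n a) }) (λ { (e , a) → (e , down n a) })
    × IsGalois (Layer X α n) (toGraph X) proj₁ proj₁ (p ^ n)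
    × DeckIsoZmod {Layer X α n} {toGraph X} {proj₁} {proj₁} (p ^ n)

-- For the constant assignment A, the voltage of a walk in X̃ is A times its weight.
--
-- If A is a unit and a cycle has weight prime to p, the voltage of that cycle is a unit
-- modulo p^n.  A deck transformation of X_n moves the fibre coordinate of each point by an
-- amount that is constant along edges; going around the cycle shows that on one fibre this
-- amount is invariant under translation by a unit, hence constant, and by connectedness it
-- is constant everywhere.  So the deck transformations are exactly the p^n translations.
--
-- Conversely, let κ x be the voltage of a path from a base vertex to x.  If every edge e
-- satisfied κ (s e) + A ≡ κ (t e) mod p, then translating by p exactly the points (x , σ)
-- of X_2 with σ ≡ κ x mod p would be a deck transformation besides the p² translations.
-- So for some edge the closed walk through it has voltage prime to p: A is a unit, and
-- cutting closed subwalks out of that walk leaves a simple cycle of weight prime to p.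

module Submission where

open import Defs

open import Data.Nat as ℕ using (ℕ; zero; suc; NonZero; _^_)
import Data.Nat.Properties as ℕ
open import Data.Nat.Properties using (m^n≢0)
import Data.Nat.Divisibility as ℕ
import Data.Nat.DivMod as ℕ
open import Data.Nat.GCD using (module Bézout)
open import Data.Nat.Coprimality as Coprime using (Coprime; coprime-Bézout; coprime-divisor; 1-coprimeTo)
open import Data.Nat.Primality using (Prime; prime⇒nonZero; prime⇒nonTrivial; prime⇒irreducible)
open import Data.Integer as ℤ using (∣_∣; ℤ; +_; -[1+_]; _+_; _*_; _-_; -_)
import Data.Integer.Properties as ℤ
open import Data.Integer.Divisibility.Signed using (_∣_; _∣?_; ∣ᵤ⇒∣; divides; ∣m∣n⇒∣m+n; ∣m⇒∣-m; ∣n⇒∣m*n; ∣m⇒∣m*n; ∣-trans; ∣⇒∣ᵤ)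
open import Data.Integer.DivMod using (_%ℕ_; _/ℕ_; n%ℕd<d; a≡a%ℕn+[a/ℕn]*n)
open import Data.Integer.Tactic.RingSolver using (solve-∀)
open import Data.List as List using (List; []; _∷_)
open import Data.List.Membership.Propositional using (_∈_; _∉_)
open import Data.List.Membership.Propositional.Properties using (∈-++⁺ˡ; ∈-++⁺ʳ; ∈-map⁺; ∈-lookup)
open import Data.List.Relation.Unary.Any using (here; there)
open import Function using (_∘_)
open import Data.Sum using (_⊎_; inj₁; inj₂)
open import Data.Bool using (true; false)
open import Data.Product using (Σ; ∃; ∃!; _,_; _×_; proj₁; proj₂; map₂; uncurry)
open import Data.Fin as Fin using (Fin; toℕ; fromℕ<; fromℕ; inject₁) renaming (zero to fzero; suc to fsuc)
import Data.Fin.Properties as Fin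
import Data.List.Membership.DecPropositional as DecMembership
open import Relation.Nullary using (¬_; yes; no; contradiction)
open import Function.Bundles using (_↔_; _⇔_; Inverse; mk↔ₛ′; mk⇔)
open import Relation.Binary.Bundles using (Setoid)
open import Relation.Binary.Structures using (IsEquivalence)
open import Relation.Binary.PropositionalEquality using (_≡_; _≢_; refl; sym; trans; cong; cong₂; subst; module ≡-Reasoning)
import Relation.Binary.Reasoning.Setoid as SetoidReasoning

-- Congruence of integers modulo a natural number

[a+b]-a≡b : ∀ a b → a + b - a ≡ b
[a+b]-a≡b = solve-∀

[a+b]-b≡a : ∀ a b → a + b - b ≡ a
[a+b]-b≡a = solve-∀

infix 4 _≡_mod_
record _≡_mod_ (x y : ℤ) (m : ℕ) : Set where
  constructor mk
  field divides-difference : + m ∣ x - y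

module _ {m : ℕ} where

  ≡-mod-reflexive : ∀ {x y} → x ≡ y → x ≡ y mod m
  ≡-mod-reflexive {x} refl = mk (divides (+ 0) (ℤ.+-inverseʳ x))

  ≡-mod-refl : ∀ {x} → x ≡ x mod m
  ≡-mod-refl = ≡-mod-reflexive refl

  ≡-mod-sym : ∀ {x y} → x ≡ y mod m → y ≡ x mod m
  ≡-mod-sym {x} {y} (mk d) = mk (subst (+ m ∣_) (negate x y) (∣m⇒∣-m d))
    where negate : ∀ x y → - (x - y) ≡ y - x
          negate = solve-∀

  ≡-mod-trans : ∀ {x y z} → x ≡ y mod m → y ≡ z mod m → x ≡ z mod m
  ≡-mod-trans {x} {y} {z} (mk d) (mk d′) = mk (subst (+ m ∣_) (telescope x y z) (∣m∣n⇒∣m+n d d′))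
    where telescope : ∀ x y z → (x - y) + (y - z) ≡ x - z
          telescope = solve-∀

  ≡-mod-isEquivalence : IsEquivalence (λ x y → x ≡ y mod m)
  ≡-mod-isEquivalence = record { refl = ≡-mod-refl ; sym = ≡-mod-sym ; trans = ≡-mod-trans }

  ≡-mod-setoid : Setoid _ _
  ≡-mod-setoid = record { isEquivalence = ≡-mod-isEquivalence }

  +-cong-mod : ∀ {x y u v} → x ≡ y mod m → u ≡ v mod m → x + u ≡ y + v mod m
  +-cong-mod {x} {y} {u} {v} (mk d) (mk d′) = mk (subst (+ m ∣_) (regroup x y u v) (∣m∣n⇒∣m+n d d′))
    where regroup : ∀ x y u v → (x - y) + (u - v) ≡ (x + u) - (y + v)
          regroup = solve-∀

  neg-cong-mod : ∀ {x y} → x ≡ y mod m → - x ≡ - y mod m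
  neg-cong-mod {x} {y} (mk d) = mk (subst (+ m ∣_) (negate x y) (∣m⇒∣-m d))
    where negate : ∀ x y → - (x - y) ≡ - x - - y
          negate = solve-∀

  *-cong-mod : ∀ {x y u v} → x ≡ y mod m → u ≡ v mod m → x * u ≡ y * v mod m
  *-cong-mod {x} {y} {u} {v} (mk d) (mk d′) =
    mk (subst (+ m ∣_) (split x y u v) (∣m∣n⇒∣m+n (∣m⇒∣m*n u d) (∣n⇒∣m*n y d′)))
    where split : ∀ x y u v → (x - y) * u + y * (u - v) ≡ x * u - y * v
          split = solve-∀

  -‿cong-mod : ∀ {x y u v} → x ≡ y mod m → u ≡ v mod m → x - u ≡ y - v mod m
  -‿cong-mod x≡y u≡v = +-cong-mod x≡y (neg-cong-mod u≡v)

  +-congˡ-mod : ∀ z {x y} → x ≡ y mod m → z + x ≡ z + y mod m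
  +-congˡ-mod z = +-cong-mod (≡-mod-refl {z})

  +-congʳ-mod : ∀ z {x y} → x ≡ y mod m → x + z ≡ y + z mod m
  +-congʳ-mod z x≡y = +-cong-mod x≡y (≡-mod-refl {z})

  -‿congʳ-mod : ∀ z {x y} → x ≡ y mod m → x - z ≡ y - z mod m
  -‿congʳ-mod z = +-congʳ-mod (- z)

  *-congˡ-mod : ∀ z {x y} → x ≡ y mod m → z * x ≡ z * y mod m
  *-congˡ-mod z = *-cong-mod (≡-mod-refl {z})

  *-congʳ-mod : ∀ z {x y} → x ≡ y mod m → x * z ≡ y * z mod m
  *-congʳ-mod z x≡y = *-cong-mod x≡y (≡-mod-refl {z})

  +-multiple-mod : ∀ x k → x + k * + m ≡ x mod m
  +-multiple-mod x k = mk (divides k (cancel x k (+ m)))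
    where cancel : ∀ x k m → x + k * m - x ≡ k * m
          cancel = solve-∀

  ∣⇒≡0-mod : ∀ {x} → + m ∣ x → x ≡ + 0 mod m
  ∣⇒≡0-mod {x} d = mk (subst (+ m ∣_) (sym (ℤ.+-identityʳ x)) d)

  ≡0-mod⇒∣ : ∀ {x} → x ≡ + 0 mod m → + m ∣ x
  ≡0-mod⇒∣ {x} (mk d) = subst (+ m ∣_) (ℤ.+-identityʳ x) d

%ℕ-≡-mod : ∀ z m .{{_ : NonZero m}} → + (z %ℕ m) ≡ z mod m
%ℕ-≡-mod z m = ≡-mod-sym (subst (_≡ + (z %ℕ m) mod m) (sym (a≡a%ℕn+[a/ℕn]*n z m)) (+-multiple-mod _ (z /ℕ m)))

module ≡-mod-Reasoning (m : ℕ) = SetoidReasoning (≡-mod-setoid {m})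

≡-mod-weaken : ∀ {k m x y} → + k ∣ + m → x ≡ y mod m → x ≡ y mod k
≡-mod-weaken k∣m (mk d) = mk (∣-trans k∣m d)

∣∧<⇒≡0 : ∀ {m n} → m ℕ.∣ n → n ℕ.< m → n ≡ 0
∣∧<⇒≡0 {n = zero}  _   _   = refl
∣∧<⇒≡0 {n = suc n} m∣n n<m = contradiction (ℕ.∣⇒≤ m∣n) (ℕ.<⇒≱ n<m)

private
  ≤∧≡-mod⇒≡ : ∀ {m a b} → a ℕ.< m → b ℕ.≤ a → + a ≡ + b mod m → a ≡ b
  ≤∧≡-mod⇒≡ {m} {a} {b} a<m b≤a (mk m∣a-b) = ℕ.≤-antisym (ℕ.m∸n≡0⇒m≤n a∸b≡0) b≤a
    where
    a-b≡a∸b : + a - + b ≡ + (a ℕ.∸ b)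
    a-b≡a∸b = trans (ℤ.m-n≡m⊖n a b) (ℤ.⊖-≥ b≤a)
    a∸b≡0 : a ℕ.∸ b ≡ 0
    a∸b≡0 = ∣∧<⇒≡0 (∣⇒∣ᵤ (subst (+ m ∣_) a-b≡a∸b m∣a-b)) (ℕ.≤-<-trans (ℕ.m∸n≤m a b) a<m)

≡-mod⇒≡ : ∀ {m a b} → a ℕ.< m → b ℕ.< m → + a ≡ + b mod m → a ≡ b
≡-mod⇒≡ a<m b<m a≡b with ℕ.≤-total _ _
... | inj₁ b≤a = ≤∧≡-mod⇒≡ a<m b≤a a≡b
... | inj₂ a≤b = sym (≤∧≡-mod⇒≡ b<m a≤b (≡-mod-sym a≡b))

%ℕ-cong : ∀ {m z w} .{{_ : NonZero m}} → z ≡ w mod m → z %ℕ m ≡ w %ℕ m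
%ℕ-cong {m} {z} {w} z≡w =
  ≡-mod⇒≡ (n%ℕd<d z m) (n%ℕd<d w m) (≡-mod-trans (%ℕ-≡-mod z m) (≡-mod-trans z≡w (≡-mod-sym (%ℕ-≡-mod w m))))

-- Units modulo m

prime∤⇒coprime : ∀ {p x} → Prime p → ¬ (p ℕ.∣ x) → Coprime x p
prime∤⇒coprime pr p∤x (d∣x , d∣p) with prime⇒irreducible pr d∣p
... | inj₁ d≡1 = d≡1
... | inj₂ refl = contradiction d∣x p∤x

coprime-^ : ∀ {x p} → Coprime x p → ∀ n → Coprime x (p ^ n)
coprime-^ {x} c zero    = Coprime.sym (1-coprimeTo x)
coprime-^ {x} {p} c (suc n) {d} (d∣x , d∣pⁿ⁺¹) = coprime-^ c n (d∣x , coprime-divisor d⊥p d∣pⁿ⁺¹)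
  where
  d⊥p : Coprime d p
  d⊥p (e∣d , e∣p) = c (ℕ.∣-trans e∣d d∣x , e∣p)

InvertibleMod : ℕ → ℤ → Set
InvertibleMod m z = ∃ λ u → z * u ≡ + 1 mod m

module _ {m : ℕ} where

  coprime⇒invertible : ∀ {x} → Coprime x m → InvertibleMod m (+ x)
  coprime⇒invertible {x} c with coprime-Bézout c
  ... | Bézout.+- a k 1+km≡ax = + a , (begin
    + x * + a          ≡⟨ trans (ℤ.pos-* a x) (ℤ.*-comm (+ a) (+ x)) ⟨
    + (a ℕ.* x)        ≡⟨ cong +_ 1+km≡ax ⟨
    + (1 ℕ.+ k ℕ.* m)  ≡⟨ trans (ℤ.pos-+ 1 (k ℕ.* m)) (cong (λ z → + 1 + z) (ℤ.pos-* k m)) ⟩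
    + 1 + + k * + m    ≈⟨ +-multiple-mod (+ 1) (+ k) ⟩
    + 1                ∎)
    where open ≡-mod-Reasoning m
  ... | Bézout.-+ a k 1+ax≡km = - + a , (begin
    + x * - + a                 ≡⟨ ℤ.neg-distribʳ-* (+ x) (+ a) ⟨
    - (+ x * + a)               ≡⟨ cong -_ (trans (ℤ.pos-* a x) (ℤ.*-comm (+ a) (+ x))) ⟨
    - + (a ℕ.* x)               ≡⟨ complement (+ (a ℕ.* x)) ⟩
    + 1 - (+ 1 + + (a ℕ.* x))   ≡⟨ cong (λ z → + 1 - z) (trans (sym (ℤ.pos-+ 1 (a ℕ.* x))) (trans (cong +_ 1+ax≡km) (ℤ.pos-* k m))) ⟩
    + 1 - + k * + m             ≡⟨ cong (λ z → + 1 + z) (ℤ.neg-distribˡ-* (+ k) (+ m)) ⟩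
    + 1 + - + k * + m           ≈⟨ +-multiple-mod (+ 1) (- + k) ⟩
    + 1                         ∎)
    where
    open ≡-mod-Reasoning m
    complement : ∀ z → - z ≡ + 1 - (+ 1 + z)
    complement = solve-∀

  invertible-neg : ∀ {z} → InvertibleMod m z → InvertibleMod m (- z)
  invertible-neg {z} (u , zu≡1) = - u , ≡-mod-trans (≡-mod-reflexive (neg-neg z u)) zu≡1
    where
    neg-neg : ∀ z u → - z * - u ≡ z * u
    neg-neg = solve-∀

  coprime-∣∣⇒invertible : ∀ {z} → Coprime ∣ z ∣ m → InvertibleMod m z
  coprime-∣∣⇒invertible {+ n}       c = coprime⇒invertible c
  coprime-∣∣⇒invertible { -[1+ n ]} c = invertible-neg {+ suc n} (coprime⇒invertible c)

  invertible-* : ∀ {y z} → InvertibleMod m y → InvertibleMod m z → InvertibleMod m (y * z)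
  invertible-* {y} {z} (u , yu≡1) (v , zv≡1) = u * v , (begin
    y * z * (u * v)   ≡⟨ regroup y z u v ⟩
    y * u * (z * v)   ≈⟨ *-cong-mod yu≡1 zv≡1 ⟩
    + 1 * + 1         ≡⟨⟩
    + 1               ∎)
    where
    open ≡-mod-Reasoning m
    regroup : ∀ y z u v → y * z * (u * v) ≡ y * u * (z * v)
    regroup = solve-∀

  inverse-unique : ∀ {x x′ u u′} → x * u ≡ + 1 mod m → x′ * u′ ≡ + 1 mod m → x′ ≡ x mod m → u′ ≡ u mod m
  inverse-unique {x} {x′} {u} {u′} xu≡1 x′u′≡1 x′≡x = begin
    u′               ≡⟨ ℤ.*-identityʳ u′ ⟨
    u′ * + 1         ≈⟨ *-congˡ-mod u′ xu≡1 ⟨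
    u′ * (x * u)     ≡⟨ regroup u′ x u ⟩
    x * u′ * u       ≈⟨ *-congʳ-mod u (*-congʳ-mod u′ x′≡x) ⟨
    x′ * u′ * u      ≈⟨ *-congʳ-mod u x′u′≡1 ⟩
    + 1 * u          ≡⟨ ℤ.*-identityˡ u ⟩
    u                ∎
    where
    open ≡-mod-Reasoning m
    regroup : ∀ u′ x u → u′ * (x * u) ≡ x * u′ * u
    regroup = solve-∀

-- ℤ/m as Fin m

⟦_⟧ : ∀ {m} → Fin m → ℤ
⟦ a ⟧ = + toℕ a

module ℤMod (m : ℕ) .{{_ : NonZero m}} where

  reduce : ℤ → Fin m
  reduce z = fromℕ< (n%ℕd<d z m)

  ⟦reduce⟧ : ∀ z → ⟦ reduce z ⟧ ≡ z mod m
  ⟦reduce⟧ z = subst (_≡ z mod m) (cong +_ (sym (Fin.toℕ-fromℕ< _))) (%ℕ-≡-mod z m)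

  ⟦⟧-injective : ∀ {a b} → ⟦ a ⟧ ≡ ⟦ b ⟧ mod m → a ≡ b
  ⟦⟧-injective {a} {b} a≡b = Fin.toℕ-injective (≡-mod⇒≡ (Fin.toℕ<n a) (Fin.toℕ<n b) a≡b)

  reduce-cong : ∀ {z w} → z ≡ w mod m → reduce z ≡ reduce w
  reduce-cong {z} {w} z≡w = ⟦⟧-injective (begin
    ⟦ reduce z ⟧ ≈⟨ ⟦reduce⟧ z ⟩
    z            ≈⟨ z≡w ⟩
    w            ≈⟨ ⟦reduce⟧ w ⟨
    ⟦ reduce w ⟧ ∎)
    where open ≡-mod-Reasoning m

  translate : ℤ → Fin m → Fin m
  translate c σ = reduce (⟦ σ ⟧ + c)

  translate-cong : ∀ {c c′} σ → c ≡ c′ mod m → translate c σ ≡ translate c′ σ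
  translate-cong σ c≡c′ = reduce-cong (+-congˡ-mod ⟦ σ ⟧ c≡c′)

  translate-identity : ∀ σ → translate (+ 0) σ ≡ σ
  translate-identity σ = ⟦⟧-injective (≡-mod-trans (⟦reduce⟧ _) (≡-mod-reflexive (ℤ.+-identityʳ ⟦ σ ⟧)))

  translate-translate : ∀ c c′ σ → translate c (translate c′ σ) ≡ translate (c′ + c) σ
  translate-translate c c′ σ = reduce-cong (begin
    ⟦ translate c′ σ ⟧ + c ≈⟨ +-congʳ-mod c (⟦reduce⟧ (⟦ σ ⟧ + c′)) ⟩
    ⟦ σ ⟧ + c′ + c         ≡⟨ ℤ.+-assoc ⟦ σ ⟧ c′ c ⟩
    ⟦ σ ⟧ + (c′ + c)       ∎)
    where open ≡-mod-Reasoning m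

  ⟦translate⟧ : ∀ c σ → ⟦ translate c σ ⟧ ≡ ⟦ σ ⟧ + c mod m
  ⟦translate⟧ c σ = ⟦reduce⟧ (⟦ σ ⟧ + c)

  translate-cancel : ∀ {c c′} σ → translate c σ ≡ translate c′ σ → c ≡ c′ mod m
  translate-cancel {c} {c′} σ eq = begin
    c                      ≡⟨ [a+b]-a≡b ⟦ σ ⟧ c ⟨
    ⟦ σ ⟧ + c - ⟦ σ ⟧      ≈⟨ -‿congʳ-mod ⟦ σ ⟧ (⟦translate⟧ c σ) ⟨
    ⟦ translate c σ ⟧ - ⟦ σ ⟧  ≡⟨ cong (λ τ → ⟦ τ ⟧ - ⟦ σ ⟧) eq ⟩
    ⟦ translate c′ σ ⟧ - ⟦ σ ⟧ ≈⟨ -‿congʳ-mod ⟦ σ ⟧ (⟦translate⟧ c′ σ) ⟩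
    ⟦ σ ⟧ + c′ - ⟦ σ ⟧     ≡⟨ [a+b]-a≡b ⟦ σ ⟧ c′ ⟩
    c′                     ∎
    where open ≡-mod-Reasoning m

  translate-comm : ∀ c c′ σ → translate c (translate c′ σ) ≡ translate c′ (translate c σ)
  translate-comm c c′ σ = begin
    translate c (translate c′ σ) ≡⟨ translate-translate c c′ σ ⟩
    translate (c′ + c) σ         ≡⟨ cong (λ z → translate z σ) (ℤ.+-comm c′ c) ⟩
    translate (c + c′) σ         ≡⟨ translate-translate c′ c σ ⟨
    translate c′ (translate c σ) ∎
    where open ≡-Reasoning

  translate-inverse : ∀ c σ → translate (- c) (translate c σ) ≡ σ
  translate-inverse c σ = begin
    translate (- c) (translate c σ) ≡⟨ translate-translate (- c) c σ ⟩
    translate (c - c) σ             ≡⟨ cong (λ z → translate z σ) (ℤ.+-inverseʳ c) ⟩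
    translate (+ 0) σ               ≡⟨ translate-identity σ ⟩
    σ                               ∎
    where open ≡-Reasoning

  translate-inverse⁻ : ∀ c σ → translate c (translate (- c) σ) ≡ σ
  translate-inverse⁻ c σ = trans (cong (λ z → translate z (translate (- c) σ)) (sym (ℤ.neg-involutive c)))
                                 (translate-inverse (- c) σ)

  module _ {ℓ} {B : Set ℓ} (g : Fin m → B) {S : ℤ} (g-invariant : ∀ σ → g (translate S σ) ≡ g σ) where

    invariant-multiple : ∀ k σ → g (translate (+ k * S) σ) ≡ g σ
    invariant-multiple zero    σ = cong g (trans (translate-cong σ (≡-mod-reflexive (ℤ.*-zeroˡ S))) (translate-identity σ))
    invariant-multiple (suc k) σ = begin
      g (translate (+ suc k * S) σ)         ≡⟨ cong g (translate-cong σ (≡-mod-reflexive (ℤ.suc-* (+ k) S))) ⟩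
      g (translate (S + + k * S) σ)         ≡⟨ cong g (translate-translate (+ k * S) S σ) ⟨
      g (translate (+ k * S) (translate S σ)) ≡⟨ invariant-multiple k (translate S σ) ⟩
      g (translate S σ)                     ≡⟨ g-invariant σ ⟩
      g σ                                   ∎
      where open ≡-Reasoning

    invariant-unit⇒constant : InvertibleMod m S → ∀ σ τ → g τ ≡ g σ
    invariant-unit⇒constant (u , Su≡1) σ τ = trans (cong g τ≡S^kσ) (invariant-multiple k σ)
      where
      d = (⟦ τ ⟧ - ⟦ σ ⟧) * u
      k = d %ℕ m
      τ≡S^kσ : τ ≡ translate (+ k * S) σ
      τ≡S^kσ = ⟦⟧-injective (begin
        ⟦ τ ⟧                               ≡⟨ unfold ⟦ σ ⟧ ⟦ τ ⟧ ⟩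
        ⟦ σ ⟧ + (⟦ τ ⟧ - ⟦ σ ⟧) * + 1       ≈⟨ +-congˡ-mod ⟦ σ ⟧ (*-congˡ-mod (⟦ τ ⟧ - ⟦ σ ⟧) Su≡1) ⟨
        ⟦ σ ⟧ + (⟦ τ ⟧ - ⟦ σ ⟧) * (S * u)   ≡⟨ regroup ⟦ σ ⟧ (⟦ τ ⟧ - ⟦ σ ⟧) S u ⟩
        ⟦ σ ⟧ + d * S                       ≈⟨ +-congˡ-mod ⟦ σ ⟧ (*-congʳ-mod S (%ℕ-≡-mod d m)) ⟨
        ⟦ σ ⟧ + + k * S                     ≈⟨ ⟦translate⟧ (+ k * S) σ ⟨
        ⟦ translate (+ k * S) σ ⟧           ∎)
        where
        open ≡-mod-Reasoning m
        unfold : ∀ s t → t ≡ s + (t - s) * + 1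
        unfold = solve-∀
        regroup : ∀ s t S u → s + t * (S * u) ≡ s + t * u * S
        regroup = solve-∀

+ₘ≡translate : ∀ {m} .{{_ : NonZero m}} (σ a : Fin m) → σ +ₘ a ≡ ℤMod.translate m ⟦ a ⟧ σ
+ₘ≡translate {suc m} σ a = refl

⟦+ₘ⟧ : ∀ {m} .{{_ : NonZero m}} (σ a : Fin m) → ⟦ σ +ₘ a ⟧ ≡ ⟦ σ ⟧ + ⟦ a ⟧ mod m
⟦+ₘ⟧ {suc m} σ a = ℤMod.⟦reduce⟧ (suc m) (⟦ σ ⟧ + ⟦ a ⟧)

-- Units of ℤₚ

module ℤₚUnits {p : ℕ} (pr : Prime p) where

  private instance
    p≢0 : NonZero p
    p≢0 = prime⇒nonZero pr

  module _ (n : ℕ) where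

    private instance
      pⁿ≢0 : NonZero (p ^ n)
      pⁿ≢0 = m^n≢0 p n

    pⁿ∣pⁿ⁺¹ : + (p ^ n) ∣ + (p ^ suc n)
    pⁿ∣pⁿ⁺¹ = divides (+ p) (ℤ.pos-* p (p ^ n))

    p∣pⁿ⁺¹ : + p ∣ + (p ^ suc n)
    p∣pⁿ⁺¹ = divides (+ (p ^ n)) (trans (ℤ.pos-* p (p ^ n)) (ℤ.*-comm (+ p) (+ (p ^ n))))

    digit-coherent : ∀ (a : ℤₚ pr) → + digit a (suc n) ≡ + digit a n mod (p ^ n)
    digit-coherent a = ≡-mod-trans (≡-mod-sym (%ℕ-≡-mod (+ digit a (suc n)) (p ^ n))) (≡-mod-reflexive (cong +_ (coh a n)))

    IsUnit⇒invertible : ∀ {a} → IsUnit pr a → InvertibleMod (p ^ n) (+ digit a n)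
    IsUnit⇒invertible {a} (b , ab≡1) = + digit b n , (begin
      + digit a n * + digit b n               ≡⟨ ℤ.pos-* (digit a n) (digit b n) ⟨
      + (digit a n ℕ.* digit b n)             ≈⟨ %ℕ-≡-mod (+ (digit a n ℕ.* digit b n)) (p ^ n) ⟨
      + ((digit a n ℕ.* digit b n) ℕ.% p ^ n) ≡⟨ cong +_ (ab≡1 n) ⟩
      + (1 ℕ.% p ^ n)                         ≈⟨ %ℕ-≡-mod (+ 1) (p ^ n) ⟩
      + 1                                     ∎)
      where open ≡-mod-Reasoning (p ^ n)

  digit-≡-digit₁ : ∀ (a : ℤₚ pr) n → + digit a (suc n) ≡ + digit a 1 mod p
  digit-≡-digit₁ a zero    = ≡-mod-refl
  digit-≡-digit₁ a (suc n) = ≡-mod-trans (≡-mod-weaken (p∣pⁿ⁺¹ n) (digit-coherent (suc n) a)) (digit-≡-digit₁ a n)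

  IsUnit-resp-≈ₚ : ∀ {a a′} → IsUnit pr a → _≈ₚ_ pr a a′ → IsUnit pr a′
  IsUnit-resp-≈ₚ (b , ab≡1) a≈a′ =
    b , λ n → subst (λ d → ℕ._%_ (d ℕ.* digit b n) (p ^ n) {{m^n≢0 p n}} ≡ _) (a≈a′ n) (ab≡1 n)

  module _ (a : ℤₚ pr) {k} (p∤aₖ₊₁ : ¬ (p ℕ.∣ digit a (suc k))) where

    digit-coprime : ∀ n → Coprime (digit a n) (p ^ n)
    digit-coprime zero    = Coprime.sym (1-coprimeTo (digit a 0))
    digit-coprime (suc n) = coprime-^ (prime∤⇒coprime pr p∤aₙ₊₁) (suc n)
      where
      p∤aₙ₊₁ : ¬ (p ℕ.∣ digit a (suc n))
      p∤aₙ₊₁ p∣aₙ₊₁ = p∤aₖ₊₁ (∣⇒∣ᵤ (≡0-mod⇒∣ (begin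
        + digit a (suc k) ≈⟨ digit-≡-digit₁ a k ⟩
        + digit a 1       ≈⟨ digit-≡-digit₁ a n ⟨
        + digit a (suc n) ≈⟨ ∣⇒≡0-mod (∣ᵤ⇒∣ p∣aₙ₊₁) ⟩
        + 0               ∎)))
        where open ≡-mod-Reasoning p

    private
      u : ℕ → ℤ
      u n = proj₁ (coprime⇒invertible (digit-coprime n))

      au≡1 : ∀ n → + digit a n * u n ≡ + 1 mod (p ^ n)
      au≡1 n = proj₂ (coprime⇒invertible (digit-coprime n))

      inverseDigit : ℕ → ℕ
      inverseDigit n = u n %ℕ p ^ n
        where instance pⁿ≢0 = m^n≢0 p n

      inverseDigit< : ∀ n → inverseDigit n ℕ.< p ^ n
      inverseDigit< n = n%ℕd<d (u n) (p ^ n)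
        where instance pⁿ≢0 = m^n≢0 p n

    module _ (n : ℕ) where

      private instance
        pⁿ≢0 : NonZero (p ^ n)
        pⁿ≢0 = m^n≢0 p n
        pⁿ⁺¹≢0 : NonZero (p ^ suc n)
        pⁿ⁺¹≢0 = m^n≢0 p (suc n)

      inverse-coherent : inverseDigit (suc n) ℕ.% p ^ n ≡ inverseDigit n
      inverse-coherent = ≡-mod⇒≡ (ℕ.m%n<n _ (p ^ n)) (inverseDigit< n) (begin
        + (inverseDigit (suc n) ℕ.% p ^ n) ≈⟨ %ℕ-≡-mod (+ inverseDigit (suc n)) (p ^ n) ⟩
        + inverseDigit (suc n)             ≈⟨ ≡-mod-weaken (pⁿ∣pⁿ⁺¹ n) (%ℕ-≡-mod (u (suc n)) (p ^ suc n)) ⟩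
        u (suc n)                          ≈⟨ inverse-unique (au≡1 n) (≡-mod-weaken (pⁿ∣pⁿ⁺¹ n) (au≡1 (suc n))) (digit-coherent n a) ⟩
        u n                                ≈⟨ %ℕ-≡-mod (u n) (p ^ n) ⟨
        + inverseDigit n                   ∎)
        where open ≡-mod-Reasoning (p ^ n)

      a·inverse≡1 : (digit a n ℕ.* inverseDigit n) ℕ.% p ^ n ≡ 1 ℕ.% p ^ n
      a·inverse≡1 = ≡-mod⇒≡ (ℕ.m%n<n _ (p ^ n)) (ℕ.m%n<n _ (p ^ n)) (begin
        + ((digit a n ℕ.* inverseDigit n) ℕ.% p ^ n) ≈⟨ %ℕ-≡-mod (+ (digit a n ℕ.* inverseDigit n)) (p ^ n) ⟩
        + (digit a n ℕ.* inverseDigit n)             ≡⟨ ℤ.pos-* (digit a n) (inverseDigit n) ⟩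
        + digit a n * + inverseDigit n               ≈⟨ *-congˡ-mod (+ digit a n) (%ℕ-≡-mod (u n) (p ^ n)) ⟩
        + digit a n * u n                            ≈⟨ au≡1 n ⟩
        + 1                                          ≈⟨ %ℕ-≡-mod (+ 1) (p ^ n) ⟨
        + (1 ℕ.% p ^ n)                              ∎)
        where open ≡-mod-Reasoning (p ^ n)

    inverse : ℤₚ pr
    inverse = record { digit = inverseDigit ; digit< = inverseDigit< ; coh = inverse-coherent }

    ¬p∣digit⇒IsUnit : IsUnit pr a
    ¬p∣digit⇒IsUnit = inverse , a·inverse≡1

-- Walks and simple cycles in X̃

module Walks (X : FinGraph) where

  infixr 5 _∷_ _++_

  data Walk : Fin (nV X) → Fin (nV X) → Set where
    []  : ∀ {x} → Walk x x
    _∷_ : ∀ {y} (d : Dart X) → Walk (dtgt X d) y → Walk (dsrc X d) y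

  weight : ∀ {x y} → Walk x y → ℤ
  weight []      = + 0
  weight (d ∷ w) = dweight {X} d + weight w

  dartVoltage : (Fin (nE X) → ℤ) → Dart X → ℤ
  dartVoltage b (e , true)  = b e
  dartVoltage b (e , false) = - b e

  voltage : (Fin (nE X) → ℤ) → ∀ {x y} → Walk x y → ℤ
  voltage b []      = + 0
  voltage b (d ∷ w) = dartVoltage b d + voltage b w

  dartVoltage-constant : ∀ {b A} → (∀ e → b e ≡ A) → ∀ d → dartVoltage b d ≡ dweight {X} d * A
  dartVoltage-constant {A = A} b≡A (e , true)  = trans (b≡A e) (sym (ℤ.*-identityˡ A))
  dartVoltage-constant {A = A} b≡A (e , false) = trans (cong -_ (b≡A e)) (sym (ℤ.-1*i≡-i A))

  voltage-constant : ∀ {b A} → (∀ e → b e ≡ A) → ∀ {x y} (w : Walk x y) → voltage b w ≡ weight w * A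
  voltage-constant b≡A [] = refl
  voltage-constant {b} {A} b≡A (d ∷ w) = begin
    dartVoltage b d + voltage b w        ≡⟨ cong₂ _+_ (dartVoltage-constant b≡A d) (voltage-constant b≡A w) ⟩
    dweight {X} d * A + weight w * A     ≡⟨ ℤ.*-distribʳ-+ A (dweight {X} d) (weight w) ⟨
    (dweight {X} d + weight w) * A       ∎
    where open ≡-Reasoning

  _++_ : ∀ {x y z} → Walk x y → Walk y z → Walk x z
  []      ++ w = w
  (d ∷ v) ++ w = d ∷ (v ++ w)

  weight-++ : ∀ {x y z} (v : Walk x y) (w : Walk y z) → weight (v ++ w) ≡ weight v + weight w
  weight-++ []      w = sym (ℤ.+-identityˡ _)
  weight-++ (d ∷ v) w = trans (cong (λ z → dweight {X} d + z) (weight-++ v w)) (sym (ℤ.+-assoc (dweight {X} d) _ _))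

  reverse : ∀ {x y} → Walk x y → Walk y x
  reverse []               = []
  reverse ((e , true) ∷ w)  = reverse w ++ (e , false) ∷ []
  reverse ((e , false) ∷ w) = reverse w ++ (e , true) ∷ []

  weight-reverse : ∀ {x y} (w : Walk x y) → weight (reverse w) ≡ - weight w
  weight-reverse [] = refl
  weight-reverse ((e , true) ∷ w) = begin
    weight (reverse w ++ (e , false) ∷ []) ≡⟨ weight-++ (reverse w) _ ⟩
    weight (reverse w) + (-[1+ 0 ] + + 0)  ≡⟨ cong (λ z → z + (-[1+ 0 ] + + 0)) (weight-reverse w) ⟩
    - weight w + (-[1+ 0 ] + + 0)          ≡⟨ negate (weight w) ⟩
    - (+ 1 + weight w)                     ∎
    where
    open ≡-Reasoning
    negate : ∀ z → - z + (-[1+ 0 ] + + 0) ≡ - (+ 1 + z)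
    negate = solve-∀
  weight-reverse ((e , false) ∷ w) = begin
    weight (reverse w ++ (e , true) ∷ []) ≡⟨ weight-++ (reverse w) _ ⟩
    weight (reverse w) + (+ 1 + + 0)      ≡⟨ cong (λ z → z + (+ 1 + + 0)) (weight-reverse w) ⟩
    - weight w + (+ 1 + + 0)              ≡⟨ negate (weight w) ⟩
    - (-[1+ 0 ] + weight w)               ∎
    where
    open ≡-Reasoning
    negate : ∀ z → - z + (+ 1 + + 0) ≡ - (-[1+ 0 ] + z)
    negate = solve-∀

  edgeLoop : ∀ {v} e → Walk v (s X e) → Walk v (t X e) → Walk v v
  edgeLoop e Pₛ Pₜ = Pₛ ++ (e , true) ∷ reverse Pₜ

  voltage-edgeLoop : ∀ {b A} → (∀ e → b e ≡ A) → ∀ {v} e (Pₛ : Walk v (s X e)) (Pₜ : Walk v (t X e)) →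
                     voltage b Pₛ + b e - voltage b Pₜ ≡ weight (edgeLoop e Pₛ Pₜ) * A
  voltage-edgeLoop {b} {A} b≡A e Pₛ Pₜ = begin
    voltage b Pₛ + b e - voltage b Pₜ              ≡⟨ cong₂ (λ x y → x + b e - y) (voltage-constant b≡A Pₛ) (voltage-constant b≡A Pₜ) ⟩
    weight Pₛ * A + b e - weight Pₜ * A            ≡⟨ cong (λ z → weight Pₛ * A + z - weight Pₜ * A) (b≡A e) ⟩
    weight Pₛ * A + A - weight Pₜ * A              ≡⟨ factor (weight Pₛ) (weight Pₜ) A ⟩
    (weight Pₛ + (+ 1 + - weight Pₜ)) * A          ≡⟨ cong (λ z → (weight Pₛ + (+ 1 + z)) * A) (weight-reverse Pₜ) ⟨
    (weight Pₛ + (+ 1 + weight (reverse Pₜ))) * A  ≡⟨ cong (_* A) (weight-++ Pₛ ((e , true) ∷ reverse Pₜ)) ⟨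
    weight (edgeLoop e Pₛ Pₜ) * A                  ∎
    where
    open ≡-Reasoning
    factor : ∀ x y a → x * a + a - y * a ≡ (x + (+ 1 + - y)) * a
    factor = solve-∀

  fromUWalk : ∀ {u v} → UWalk X u v → Walk u v
  fromUWalk here      = []
  fromUWalk (fwd e w) = (e , true) ∷ fromUWalk w
  fromUWalk (bwd e w) = (e , false) ∷ fromUWalk w


data Distinct {A : Set} : List A → Set where
  []  : Distinct []
  _∷_ : ∀ {x l} → x ∉ l → Distinct l → Distinct (x ∷ l)

distinct-++⁻ : ∀ {A : Set} (l₁ : List A) {l₂} → Distinct (l₁ List.++ l₂) →
               Distinct l₁ × Distinct l₂ × (∀ {z} → z ∈ l₁ → z ∉ l₂)
distinct-++⁻ []       d        = [] , d , λ ()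
distinct-++⁻ (x ∷ l₁) (x∉ ∷ d) with distinct-++⁻ l₁ d
... | d₁ , d₂ , disjoint =
  (λ x∈l₁ → x∉ (∈-++⁺ˡ x∈l₁)) ∷ d₁ , d₂ ,
  λ { (here refl) x∈l₂ → x∉ (∈-++⁺ʳ l₁ x∈l₂) ; (there z∈l₁) → disjoint z∈l₁ }

distinct-lookup-injective : ∀ {A B : Set} (f : A → B) (l : List A) → Distinct (List.map f l) →
                            ∀ i j → f (List.lookup l i) ≡ f (List.lookup l j) → i ≡ j
distinct-lookup-injective f (x ∷ l) (x∉ ∷ d) fzero    fzero    _  = refl
distinct-lookup-injective f (x ∷ l) (x∉ ∷ d) fzero    (fsuc j) eq =
  contradiction (subst (_∈ List.map f l) (sym eq) (∈-map⁺ f (∈-lookup j))) x∉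
distinct-lookup-injective f (x ∷ l) (x∉ ∷ d) (fsuc i) fzero    eq =
  contradiction (subst (_∈ List.map f l) eq (∈-map⁺ f (∈-lookup i))) x∉
distinct-lookup-injective f (x ∷ l) (x∉ ∷ d) (fsuc i) (fsuc j) eq = cong fsuc (distinct-lookup-injective f l d i j eq)

module Cycles (X : FinGraph) where

  open Walks X
  open DecMembership (Fin._≟_ {nV X}) using (_∈?_)

  darts : ∀ {x y} → Walk x y → List (Dart X)
  darts []      = []
  darts (d ∷ w) = d ∷ darts w

  sources : ∀ {x y} → Walk x y → List (Fin (nV X))
  sources w = List.map (dsrc X) (darts w)

  vertices : ∀ {x y} → Walk x y → List (Fin (nV X))
  vertices {y = y} [] = y ∷ []
  vertices (d ∷ w)    = dsrc X d ∷ vertices w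

  weight≡∑ : ∀ {x y} (w : Walk x y) → weight w ≡ ∑ (λ i → dweight {X} (List.lookup (darts w) i))
  weight≡∑ []      = refl
  weight≡∑ (d ∷ w) = cong (λ z → dweight {X} d + z) (weight≡∑ w)

  walkAlong : ∀ k (f : Fin (suc k) → Dart X) → (∀ i → dtgt X (f (inject₁ i)) ≡ dsrc X (f (fsuc i))) →
              ∀ {x y} → x ≡ dsrc X (f fzero) → dtgt X (f (fromℕ k)) ≡ y → Walk x y
  walkAlong zero    f consecutive refl refl = f fzero ∷ []
  walkAlong (suc k) f consecutive refl end  = f fzero ∷ walkAlong k (f ∘ fsuc) (consecutive ∘ fsuc) (consecutive fzero) end

  weight-walkAlong : ∀ k f consecutive {x y} (start : x ≡ dsrc X (f fzero)) (end : dtgt X (f (fromℕ k)) ≡ y) →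
                     weight (walkAlong k f consecutive start end) ≡ ∑ (λ i → dweight {X} (f i))
  weight-walkAlong zero    f consecutive refl refl = refl
  weight-walkAlong (suc k) f consecutive refl end  =
    cong (λ z → dweight {X} (f fzero) + z) (weight-walkAlong k (f ∘ fsuc) (consecutive ∘ fsuc) (consecutive fzero) end)

  cycleWalk : (c : DirCycle X) → Walk (dsrc X (dart c fzero)) (dsrc X (dart c fzero))
  cycleWalk c = walkAlong (len c) (dart c) (consec c) refl (closes c)

  weight-cycleWalk : ∀ c → weight (cycleWalk c) ≡ cycleWeight c
  weight-cycleWalk c = weight-walkAlong (len c) (dart c) (consec c) refl (closes c)

  private
    lookup-consecutive : ∀ d {x y} (w : Walk x y) → dtgt X d ≡ x → ∀ i →
                         dtgt X (List.lookup (d ∷ darts w) (inject₁ i)) ≡ dsrc X (List.lookup (darts w) i)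
    lookup-consecutive d (d′ ∷ w) d→ fzero    = d→
    lookup-consecutive d (d′ ∷ w) d→ (fsuc i) = lookup-consecutive d′ w refl i

    lookup-last : ∀ d {x y} (w : Walk x y) → dtgt X d ≡ x →
                  dtgt X (List.lookup (d ∷ darts w) (fromℕ (List.length (darts w)))) ≡ y
    lookup-last d []        d→ = d→
    lookup-last d (d′ ∷ w)  d→ = lookup-last d′ w refl

  closedWalk⇒DirCycle : ∀ d (w : Walk (dtgt X d) (dsrc X d)) → Distinct (sources (d ∷ w)) → DirCycle X
  closedWalk⇒DirCycle d w distinct = record
    { len    = List.length (darts w)
    ; dart   = List.lookup (d ∷ darts w)
    ; consec = lookup-consecutive d w refl
    ; closes = lookup-last d w refl
    ; simple = distinct-lookup-injective (dsrc X) (d ∷ darts w) distinct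
    }

  weight-closedWalk⇒DirCycle : ∀ d w distinct → cycleWeight (closedWalk⇒DirCycle d w distinct) ≡ weight (d ∷ w)
  weight-closedWalk⇒DirCycle d w _ = sym (weight≡∑ (d ∷ w))

  splitAt : ∀ {x y} (w : Walk x y) {z} → z ∈ vertices w →
            Σ (Walk x z) λ u → Σ (Walk z y) λ v → weight w ≡ weight u + weight v × vertices w ≡ sources u List.++ vertices v
  splitAt []      (here refl)  = [] , [] , refl , refl
  splitAt (d ∷ w) (here refl)  = [] , d ∷ w , sym (ℤ.+-identityˡ _) , refl
  splitAt (d ∷ w) (there z∈w) with splitAt w z∈w
  ... | u , v , w≡u+v , vertices≡ =
    d ∷ u , v , trans (cong (λ z → dweight {X} d + z) w≡u+v) (sym (ℤ.+-assoc (dweight {X} d) _ _)) , cong (dsrc X d ∷_) vertices≡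

  start∈vertices : ∀ {x y} (w : Walk x y) → x ∈ vertices w
  start∈vertices []      = here refl
  start∈vertices (d ∷ w) = here refl

  end∈vertices : ∀ {x y} (w : Walk x y) → y ∈ vertices w
  end∈vertices []      = here refl
  end∈vertices (d ∷ w) = there (end∈vertices w)

  module _ (k : ℕ) where

    CycleOfWeightNotDividedBy : Set
    CycleOfWeightNotDividedBy = Σ (DirCycle X) λ c → ¬ (+ k ∣ cycleWeight c)

    -- Either such a cycle is found, or cutting out the closed subwalks of w leaves a path
    -- of the same weight modulo k.
    shortcut : ∀ {x y} (w : Walk x y) →
               CycleOfWeightNotDividedBy ⊎ Σ (Walk x y) (λ q → Distinct (vertices q) × weight q ≡ weight w mod k)
    shortcut [] = inj₂ ([] , (λ ()) ∷ [] , ≡-mod-refl)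
    shortcut (d ∷ w) with shortcut w
    ... | inj₁ cycle = inj₁ cycle
    ... | inj₂ (q , distinct , q≡w) with dsrc X d ∈? vertices q
    ...   | no  d∉q = inj₂ (d ∷ q , d∉q ∷ distinct , +-congˡ-mod (dweight {X} d) q≡w)
    ...   | yes d∈q with splitAt q d∈q
    ...     | u , v , q≡u+v , vertices≡ with distinct-++⁻ (sources u) (subst Distinct vertices≡ distinct)
    ...       | distinct-u , distinct-v , disjoint with + k ∣? weight (d ∷ u)
    ...         | no k∤du = inj₁ (cycle , λ k∣c → k∤du (subst (+ k ∣_) (weight-closedWalk⇒DirCycle d u distinct-du) k∣c))
      where
      distinct-du = (λ d∈u → disjoint d∈u (start∈vertices v)) ∷ distinct-u
      cycle = closedWalk⇒DirCycle d u distinct-du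
    ...         | yes k∣du = inj₂ (v , distinct-v , (begin
      weight v                              ≡⟨ ℤ.+-identityˡ (weight v) ⟨
      + 0 + weight v                        ≈⟨ +-congʳ-mod (weight v) (∣⇒≡0-mod k∣du) ⟨
      dweight {X} d + weight u + weight v   ≡⟨ ℤ.+-assoc (dweight {X} d) (weight u) (weight v) ⟩
      dweight {X} d + (weight u + weight v) ≡⟨ cong (λ z → dweight {X} d + z) q≡u+v ⟨
      dweight {X} d + weight q              ≈⟨ +-congˡ-mod (dweight {X} d) q≡w ⟩
      dweight {X} d + weight w              ∎))
      where open ≡-mod-Reasoning k

    closedWalk⇒cycle : ∀ {v} (w : Walk v v) → ¬ (+ k ∣ weight w) → CycleOfWeightNotDividedBy
    closedWalk⇒cycle w k∤w with shortcut w
    ... | inj₁ cycle = cycle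
    ... | inj₂ ([]    , _          , 0≡w) = contradiction (≡0-mod⇒∣ (≡-mod-sym 0≡w)) k∤w
    ... | inj₂ (d ∷ q , d∉q ∷ _    , _  ) = contradiction (end∈vertices q) d∉q

-- Deck transformations of derived graphs

inhabited-or-empty : ∀ n → Fin n ⊎ ¬ Fin n
inhabited-or-empty zero    = inj₂ λ ()
inhabited-or-empty (suc n) = inj₁ fzero

module _ {Y X : Graph} {πV : Vtx Y → Vtx X} {πE : Edg Y → Edg X} where

  ≈D-sym : ∀ {D D′ : Deck Y X πV πE} → D ≈D D′ → D′ ≈D D
  ≈D-sym (onV , onE) = (λ y → sym (onV y)) , (λ e → sym (onE e))

  ≈D-trans : ∀ {D D′ D″ : Deck Y X πV πE} → D ≈D D′ → D′ ≈D D″ → D ≈D D″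
  ≈D-trans (onV , onE) (onV′ , onE′) = (λ y → trans (onV y) (onV′ y)) , (λ e → trans (onE e) (onE′ e))

  injection⇒≤-deckOrder : ∀ {d n} → DeckOrder {Y} {X} {πV} {πE} d →
                          (g : Fin n → Deck Y X πV πE) → (∀ i j → g i ≈D g j → i ≡ j) → n ℕ.≤ d
  injection⇒≤-deckOrder (ψ , onto , _) g g-injective = ℕ.≮⇒≥ λ d<n →
    let (i , j , i<j , same) = Fin.pigeonhole d<n (λ k → proj₁ (onto (g k)))
        gi≈ψ : g i ≈D ψ (proj₁ (onto (g j)))
        gi≈ψ = subst (λ k → g i ≈D ψ k) same (≈D-sym {D = ψ _} {D′ = g i} (proj₂ (onto (g i))))
    in Fin.<-irrefl (g-injective i j (≈D-trans {D = g i} {D′ = ψ _} {D″ = g j} gi≈ψ (proj₂ (onto (g j))))) i<j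

module DerivedGraph (X : FinGraph) {m : ℕ} .{{_ : NonZero m}} (β : Fin (nE X) → Fin m) where

  open ℤMod m
  open Walks X

  Y : Graph
  Y = Derived X β

  DeckTransformation : Set
  DeckTransformation = Deck Y (toGraph X) proj₁ proj₁

  b : Fin (nE X) → ℤ
  b e = ⟦ β e ⟧

  +ₘ-translate : ∀ e σ → σ +ₘ β e ≡ translate (b e) σ
  +ₘ-translate e σ = +ₘ≡translate σ (β e)

  lift-+ₘ : ∀ e σ → translate (- b e) σ +ₘ β e ≡ σ
  lift-+ₘ e σ = trans (+ₘ-translate e _) (translate-inverse⁻ (b e) σ)

  +ₘ-lift : ∀ e σ → translate (- b e) (σ +ₘ β e) ≡ σ
  +ₘ-lift e σ = trans (cong (translate (- b e)) (+ₘ-translate e σ)) (translate-inverse (b e) σ)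

  covering : IsCovering Y (toGraph X) proj₁ proj₁
  covering = record
    { morphism = record { src-comm = λ _ → refl ; tgt-comm = λ _ → refl }
    ; out-bij  = λ { (x , σ) e refl → (e , σ) , (refl , refl) , λ { (refl , refl) → refl } }
    ; in-bij   = λ { (x , σ) e refl → (e , translate (- b e) σ) , (cong (x ,_) (lift-+ₘ e σ) , refl)
                                   , λ { {e , τ} (refl , refl) → cong (e ,_) (+ₘ-lift e τ) } }
    }

  fibre : ∀ x → Fin m ↔ Σ (Vtx Y) (λ y → proj₁ y ≡ x)
  fibre x = mk↔ₛ′ (λ σ → (x , σ) , refl) (λ ((_ , σ) , _) → σ) (λ { ((_ , σ) , refl) → refl }) (λ _ → refl)

  module FibrewiseTranslation
    (shift : Fin (nV X) → Fin m → ℤ)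
    (shift-edge : ∀ e σ → shift (t X e) (σ +ₘ β e) ≡ shift (s X e) σ)
    (shift-stable : ∀ x σ → shift x (translate (shift x σ) σ) ≡ shift x σ)
    (shift-stable⁻ : ∀ x σ → shift x (translate (- shift x σ) σ) ≡ shift x σ)
    where

    move : Fin (nV X) → Fin m → Fin m
    move x σ = translate (shift x σ) σ

    unmove : Fin (nV X) → Fin m → Fin m
    unmove x σ = translate (- shift x σ) σ

    move-unmove : ∀ x σ → move x (unmove x σ) ≡ σ
    move-unmove x σ = trans (cong (λ c → translate c (unmove x σ)) (shift-stable⁻ x σ)) (translate-inverse⁻ (shift x σ) σ)

    unmove-move : ∀ x σ → unmove x (move x σ) ≡ σ
    unmove-move x σ = trans (cong (λ c → translate (- c) (move x σ)) (shift-stable x σ)) (translate-inverse (shift x σ) σ)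

    move-+ₘ : ∀ e σ → move (s X e) σ +ₘ β e ≡ move (t X e) (σ +ₘ β e)
    move-+ₘ e σ = begin
      translate c σ +ₘ β e                 ≡⟨ +ₘ-translate e _ ⟩
      translate (b e) (translate c σ)      ≡⟨ translate-comm (b e) c σ ⟩
      translate c (translate (b e) σ)      ≡⟨ cong (translate c) (+ₘ-translate e σ) ⟨
      translate c (σ +ₘ β e)               ≡⟨ cong (λ c′ → translate c′ (σ +ₘ β e)) (shift-edge e σ) ⟨
      move (t X e) (σ +ₘ β e)              ∎
      where
      open ≡-Reasoning
      c = shift (s X e) σ

    deck : DeckTransformation
    deck = record
      { dV = mk↔ₛ′ (λ (x , σ) → x , move x σ) (λ (x , σ) → x , unmove x σ)
                   (λ (x , σ) → cong (x ,_) (move-unmove x σ)) (λ (x , σ) → cong (x ,_) (unmove-move x σ))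
      ; dE = mk↔ₛ′ (λ (e , σ) → e , move (s X e) σ) (λ (e , σ) → e , unmove (s X e) σ)
                   (λ (e , σ) → cong (e ,_) (move-unmove (s X e) σ)) (λ (e , σ) → cong (e ,_) (unmove-move (s X e) σ))
      ; src-pres = λ _ → refl
      ; tgt-pres = λ (e , σ) → cong (t X e ,_) (move-+ₘ e σ)
      ; projV = λ _ → refl
      ; projE = λ _ → refl
      }

  translation : Fin m → DeckTransformation
  translation i = FibrewiseTranslation.deck (λ _ _ → ⟦ i ⟧) (λ _ _ → refl) (λ _ _ → refl) (λ _ _ → refl)

  translation-+ₘ : ∀ i j → IsComposite (translation (i +ₘ j)) (translation i) (translation j)
  translation-+ₘ i j = (λ (x , σ) → cong (x ,_) (compose σ)) , (λ (e , σ) → cong (e ,_) (compose σ))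
    where
    compose : ∀ σ → translate ⟦ i +ₘ j ⟧ σ ≡ translate ⟦ i ⟧ (translate ⟦ j ⟧ σ)
    compose σ = begin
      translate ⟦ i +ₘ j ⟧ σ            ≡⟨ translate-cong σ (⟦+ₘ⟧ i j) ⟩
      translate (⟦ i ⟧ + ⟦ j ⟧) σ       ≡⟨ cong (λ c → translate c σ) (ℤ.+-comm ⟦ i ⟧ ⟦ j ⟧) ⟩
      translate (⟦ j ⟧ + ⟦ i ⟧) σ       ≡⟨ translate-translate ⟦ i ⟧ ⟦ j ⟧ σ ⟨
      translate ⟦ i ⟧ (translate ⟦ j ⟧ σ) ∎
      where open ≡-Reasoning

  translation-injective : Fin (nV X) → ∀ i j → translation i ≈D translation j → i ≡ j
  translation-injective x i j (i≈j , _) =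
    ⟦⟧-injective (translate-cancel (reduce (+ 0)) (cong proj₂ (i≈j (x , reduce (+ 0)))))

  EdgeInvariant : ∀ {ℓ} {B : Set ℓ} → (Vtx Y → B) → Set ℓ
  EdgeInvariant Φ = ∀ e σ → Φ (t X e , σ +ₘ β e) ≡ Φ (s X e , σ)

  module _ {ℓ} {B : Set ℓ} {Φ : Vtx Y → B} (Φ-inv : EdgeInvariant Φ) where

    invariant-along-walk : ∀ {x y} (w : Walk x y) σ → Φ (y , translate (voltage b w) σ) ≡ Φ (x , σ)
    invariant-along-walk [] σ = cong (λ τ → Φ (_ , τ)) (translate-identity σ)
    invariant-along-walk ((e , true) ∷ w) σ = begin
      Φ (_ , translate (b e + voltage b w) σ)             ≡⟨ cong (λ τ → Φ (_ , τ)) (translate-translate (voltage b w) (b e) σ) ⟨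
      Φ (_ , translate (voltage b w) (translate (b e) σ)) ≡⟨ cong (λ τ → Φ (_ , translate (voltage b w) τ)) (+ₘ-translate e σ) ⟨
      Φ (_ , translate (voltage b w) (σ +ₘ β e))          ≡⟨ invariant-along-walk w (σ +ₘ β e) ⟩
      Φ (t X e , σ +ₘ β e)                                ≡⟨ Φ-inv e σ ⟩
      Φ (s X e , σ)                                       ∎
      where open ≡-Reasoning
    invariant-along-walk ((e , false) ∷ w) σ = begin
      Φ (_ , translate (- b e + voltage b w) σ)           ≡⟨ cong (λ τ → Φ (_ , τ)) (translate-translate (voltage b w) (- b e) σ) ⟨
      Φ (_ , translate (voltage b w) σ′)                  ≡⟨ invariant-along-walk w σ′ ⟩
      Φ (s X e , σ′)                                      ≡⟨ Φ-inv e σ′ ⟨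
      Φ (t X e , σ′ +ₘ β e)                               ≡⟨ cong (λ τ → Φ (t X e , τ)) (lift-+ₘ e σ) ⟩
      Φ (t X e , σ)                                       ∎
      where
      open ≡-Reasoning
      σ′ = translate (- b e) σ

  module _ (D : DeckTransformation) where

    private
      toV = Inverse.to (dV D)
      toE = Inverse.to (dE D)

    displacement : Vtx Y → Fin m
    displacement (x , σ) = reduce (⟦ proj₂ (toV (x , σ)) ⟧ - ⟦ σ ⟧)

    displacement-invariant : EdgeInvariant displacement
    displacement-invariant e σ with toE (e , σ) | projE D (e , σ) | src-pres D (e , σ) | tgt-pres D (e , σ)
    ... | (e , σ′) | refl | src≡ | tgt≡ = reduce-cong (begin
      ⟦ proj₂ (toV (t X e , σ +ₘ β e)) ⟧ - ⟦ σ +ₘ β e ⟧ ≡⟨ cong (λ y → ⟦ proj₂ y ⟧ - ⟦ σ +ₘ β e ⟧) tgt≡ ⟨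
      ⟦ σ′ +ₘ β e ⟧ - ⟦ σ +ₘ β e ⟧                      ≈⟨ -‿cong-mod (⟦+ₘ⟧ σ′ (β e)) (⟦+ₘ⟧ σ (β e)) ⟩
      (⟦ σ′ ⟧ + b e) - (⟦ σ ⟧ + b e)                    ≡⟨ cancel ⟦ σ′ ⟧ ⟦ σ ⟧ (b e) ⟩
      ⟦ σ′ ⟧ - ⟦ σ ⟧                                    ≡⟨ cong (λ y → ⟦ proj₂ y ⟧ - ⟦ σ ⟧) src≡ ⟩
      ⟦ proj₂ (toV (s X e , σ)) ⟧ - ⟦ σ ⟧               ∎)
      where
      open ≡-mod-Reasoning m
      cancel : ∀ a a′ c → (a + c) - (a′ + c) ≡ a - a′
      cancel = solve-∀

    translate-displacement : ∀ y → translate ⟦ displacement y ⟧ (proj₂ y) ≡ proj₂ (toV y)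
    translate-displacement (x , σ) = ⟦⟧-injective (begin
      ⟦ translate ⟦ displacement (x , σ) ⟧ σ ⟧ ≈⟨ ⟦translate⟧ ⟦ displacement (x , σ) ⟧ σ ⟩
      ⟦ σ ⟧ + ⟦ displacement (x , σ) ⟧         ≈⟨ +-congˡ-mod ⟦ σ ⟧ (⟦reduce⟧ (⟦ proj₂ (toV (x , σ)) ⟧ - ⟦ σ ⟧)) ⟩
      ⟦ σ ⟧ + (⟦ proj₂ (toV (x , σ)) ⟧ - ⟦ σ ⟧) ≡⟨ restore ⟦ σ ⟧ ⟦ proj₂ (toV (x , σ)) ⟧ ⟩
      ⟦ proj₂ (toV (x , σ)) ⟧                  ∎)
      where
      open ≡-mod-Reasoning m
      restore : ∀ a c → a + (c - a) ≡ c
      restore = solve-∀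

    constant-displacement⇒translation : ∀ i → (∀ y → displacement y ≡ i) → translation i ≈D D
    constant-displacement⇒translation i const = onVertices , onEdges
      where
      fibreCoordinate : ∀ y → translate ⟦ i ⟧ (proj₂ y) ≡ proj₂ (toV y)
      fibreCoordinate y = trans (cong (λ j → translate ⟦ j ⟧ (proj₂ y)) (sym (const y))) (translate-displacement y)
      onVertices : ∀ y → Inverse.to (dV (translation i)) y ≡ toV y
      onVertices y = cong₂ _,_ (sym (projV D y)) (fibreCoordinate y)
      onEdges : ∀ ε → Inverse.to (dE (translation i)) ε ≡ toE ε
      onEdges (e , σ) =
        cong₂ _,_ (sym (projE D (e , σ))) (trans (fibreCoordinate (s X e , σ)) (sym (cong proj₂ (src-pres D (e , σ)))))

  deckOrder⇒no-extra-deck : Fin (nV X) → DeckOrder {Y} {toGraph X} {proj₁} {proj₁} m →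
                                        ∀ D → ¬ (∀ i → ¬ translation i ≈D D)
  deckOrder⇒no-extra-deck x order D D≉translations =
    ℕ.<-irrefl refl (injection⇒≤-deckOrder order extended extended-injective)
    where
    extended : Fin (suc m) → DeckTransformation
    extended fzero    = D
    extended (fsuc i) = translation i
    extended-injective : ∀ i j → extended i ≈D extended j → i ≡ j
    extended-injective fzero    fzero    _   = refl
    extended-injective fzero    (fsuc j) D≈j = contradiction (≈D-sym {D = D} {D′ = translation j} D≈j) (D≉translations j)
    extended-injective (fsuc i) fzero    i≈D = contradiction i≈D (D≉translations i)
    extended-injective (fsuc i) (fsuc j) i≈j = cong fsuc (translation-injective x i j i≈j)

  module _ (connected : Connected X) {v} (W : Walk v v) (W-invertible : InvertibleMod m (voltage b W)) where

    invariant⇒constant : ∀ {ℓ} {B : Set ℓ} {Φ : Vtx Y → B} → EdgeInvariant Φ → ∀ y → Φ y ≡ Φ (v , reduce (+ 0))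
    invariant⇒constant {Φ = Φ} Φ-inv (x , σ) = begin
      Φ (x , σ)                         ≡⟨ invariant-along-walk {Φ = Φ} Φ-inv P σ ⟨
      Φ (v , translate (voltage b P) σ) ≡⟨ invariant-unit⇒constant (λ τ → Φ (v , τ)) {voltage b W} (invariant-along-walk {Φ = Φ} Φ-inv W)
                                             W-invertible (reduce (+ 0)) (translate (voltage b P) σ) ⟩
      Φ (v , reduce (+ 0))              ∎
      where
      open ≡-Reasoning
      P = fromUWalk (connected x v)

    every-deck-is-translation : ∀ D → ∃ λ i → translation i ≈D D
    every-deck-is-translation D =
      displacement D (v , reduce (+ 0)) ,
      constant-displacement⇒translation D _ (invariant⇒constant {Φ = displacement D} (displacement-invariant D))

  -- A potential κ of the voltages modulo p yields a deck transformation that is not a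
  -- translation: translate by p exactly the points of colour 0.
  module PartialTranslation {p} .{{_ : NonZero p}} (p∣m : + p ∣ + m)
    (κ : Fin (nV X) → ℤ) (κ-potential : ∀ e → κ (s X e) + b e ≡ κ (t X e) mod p) where

    colour : Fin (nV X) → Fin m → ℕ
    colour x σ = (⟦ σ ⟧ - κ x) %ℕ p

    bump : ℕ → ℤ
    bump zero    = + p
    bump (suc _) = + 0

    shift : Fin (nV X) → Fin m → ℤ
    shift x σ = bump (colour x σ)

    colour-translate : ∀ {c} x σ → + p ∣ c → colour x (translate c σ) ≡ colour x σ
    colour-translate {c} x σ p∣c = %ℕ-cong (begin
      ⟦ translate c σ ⟧ - κ x ≈⟨ ≡-mod-weaken p∣m (-‿congʳ-mod (κ x) (⟦translate⟧ c σ)) ⟩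
      ⟦ σ ⟧ + c - κ x         ≈⟨ -‿congʳ-mod (κ x) (+-congˡ-mod ⟦ σ ⟧ (∣⇒≡0-mod p∣c)) ⟩
      ⟦ σ ⟧ + + 0 - κ x       ≡⟨ cong (_- κ x) (ℤ.+-identityʳ ⟦ σ ⟧) ⟩
      ⟦ σ ⟧ - κ x             ∎)
      where open ≡-mod-Reasoning p

    p∣bump : ∀ n → + p ∣ bump n
    p∣bump zero    = divides (+ 1) (sym (ℤ.*-identityˡ (+ p)))
    p∣bump (suc _) = divides (+ 0) refl

    shift-edge : ∀ e σ → shift (t X e) (σ +ₘ β e) ≡ shift (s X e) σ
    shift-edge e σ = cong bump (%ℕ-cong (begin
      ⟦ σ +ₘ β e ⟧ - κ (t X e)             ≈⟨ ≡-mod-weaken p∣m (-‿congʳ-mod (κ (t X e)) (⟦+ₘ⟧ σ (β e))) ⟩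
      ⟦ σ ⟧ + b e - κ (t X e)              ≈⟨ -‿cong-mod (≡-mod-refl {x = ⟦ σ ⟧ + b e}) (κ-potential e) ⟨
      ⟦ σ ⟧ + b e - (κ (s X e) + b e)      ≡⟨ cancel ⟦ σ ⟧ (κ (s X e)) (b e) ⟩
      ⟦ σ ⟧ - κ (s X e)                    ∎))
      where
      open ≡-mod-Reasoning p
      cancel : ∀ a k c → a + c - (k + c) ≡ a - k
      cancel = solve-∀

    deck : DeckTransformation
    deck = FibrewiseTranslation.deck shift shift-edge
      (λ x σ → cong bump (colour-translate x σ (p∣bump (colour x σ))))
      (λ x σ → cong bump (colour-translate x σ (∣m⇒∣-m (p∣bump (colour x σ)))))

    deck-not-translation : 1 ℕ.< p → ¬ (+ m ∣ + p) → Fin (nV X) → ∀ i → ¬ (translation i ≈D deck)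
    deck-not-translation 1<p m∤p x i (i≈deck , _) = m∤p (≡0-mod⇒∣ (≡-mod-trans (≡-mod-sym i≡p) i≡0))
      where
      σ : ℕ → Fin m
      σ c = reduce (κ x + + c)
      colour-σ : ∀ {c} → c ℕ.< p → colour x (σ c) ≡ c
      colour-σ {c} c<p = trans (%ℕ-cong (begin
        ⟦ σ c ⟧ - κ x   ≈⟨ ≡-mod-weaken p∣m (-‿congʳ-mod (κ x) (⟦reduce⟧ (κ x + + c))) ⟩
        κ x + + c - κ x ≡⟨ [a+b]-a≡b (κ x) (+ c) ⟩
        + c             ∎)) (ℕ.m<n⇒m%n≡m c<p)
        where open ≡-mod-Reasoning p
      moved : ∀ {c} → c ℕ.< p → translate ⟦ i ⟧ (σ c) ≡ translate (bump c) (σ c)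
      moved {c} c<p = trans (cong proj₂ (i≈deck (x , σ c))) (cong (λ n → translate (bump n) (σ c)) (colour-σ c<p))
      i≡p : ⟦ i ⟧ ≡ + p mod m
      i≡p = translate-cancel (σ 0) (moved (ℕ.<-trans ℕ.z<s 1<p))
      i≡0 : ⟦ i ⟧ ≡ + 0 mod m
      i≡0 = translate-cancel (σ 1) (moved 1<p)

  deckOrder-excludes-potential : ∀ {p} .{{_ : NonZero p}} → 1 ℕ.< p → + p ∣ + m → ¬ (+ m ∣ + p) →
    Fin (nV X) → DeckOrder {Y} {toGraph X} {proj₁} {proj₁} m →
    (κ : Fin (nV X) → ℤ) → ¬ (∀ e → κ (s X e) + b e ≡ κ (t X e) mod p)
  deckOrder-excludes-potential 1<p p∣m m∤p x order κ κ-potential =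
    deckOrder⇒no-extra-deck x order deck (deck-not-translation 1<p m∤p x)
    where open PartialTranslation p∣m κ κ-potential

  deckOrder⇒vertex : 1 ℕ.< m → DeckOrder {Y} {toGraph X} {proj₁} {proj₁} m → Fin (nV X)
  deckOrder⇒vertex 1<m (ψ , _ , ψ-injective) with inhabited-or-empty (nV X)
  ... | inj₁ x     = x
  ... | inj₂ empty = contradiction (cong toℕ (ψ-injective (fromℕ< 0<m) (fromℕ< 1<m) vacuous)) 0≢1
    where
    0<m = ℕ.<-trans ℕ.z<s 1<m
    vacuous : ψ (fromℕ< 0<m) ≈D ψ (fromℕ< 1<m)
    vacuous = (λ (x , _) → contradiction x empty) , (λ (e , _) → contradiction (s X e) empty)
    0≢1 : toℕ (fromℕ< 0<m) ≢ toℕ (fromℕ< 1<m)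
    0≢1 eq with () ← trans (sym (Fin.toℕ-fromℕ< 0<m)) (trans eq (Fin.toℕ-fromℕ< 1<m))

module Reduction (X : FinGraph) {m′ m : ℕ} .{{_ : NonZero m′}} .{{_ : NonZero m}} (m∣m′ : + m ∣ + m′)
  (β′ : Fin (nE X) → Fin m′) (β : Fin (nE X) → Fin m) (β′≡β : ∀ e → ⟦ β′ e ⟧ ≡ ⟦ β e ⟧ mod m) where

  private
    module Up   = DerivedGraph X β′
    module Down = DerivedGraph X β

  π : Fin m′ → Fin m
  π a = ℤMod.reduce m ⟦ a ⟧

  ⟦π⟧ : ∀ a → ⟦ π a ⟧ ≡ ⟦ a ⟧ mod m
  ⟦π⟧ a = ℤMod.⟦reduce⟧ m ⟦ a ⟧

  π-+ₘ : ∀ a e → π a +ₘ β e ≡ π (a +ₘ β′ e)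
  π-+ₘ a e = ℤMod.⟦⟧-injective m (begin
    ⟦ π a +ₘ β e ⟧         ≈⟨ ⟦+ₘ⟧ (π a) (β e) ⟩
    ⟦ π a ⟧ + ⟦ β e ⟧       ≈⟨ +-cong-mod (⟦π⟧ a) (≡-mod-sym (β′≡β e)) ⟩
    ⟦ a ⟧ + ⟦ β′ e ⟧        ≈⟨ ≡-mod-weaken m∣m′ (⟦+ₘ⟧ a (β′ e)) ⟨
    ⟦ a +ₘ β′ e ⟧           ≈⟨ ⟦π⟧ (a +ₘ β′ e) ⟨
    ⟦ π (a +ₘ β′ e) ⟧       ∎)
    where open ≡-mod-Reasoning m

  πV : Vtx Up.Y → Vtx Down.Y
  πV (x , a) = x , π a

  πE : Edg Up.Y → Edg Down.Y
  πE (e , a) = e , π a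

  covering : IsCovering Up.Y Down.Y πV πE
  covering = record
    { morphism = record { src-comm = λ _ → refl ; tgt-comm = λ (e , a) → cong (t X e ,_) (π-+ₘ a e) }
    ; out-bij  = λ { (x , a) (e , c) refl → (e , a) , (refl , refl) ,
                       λ (h₁ , h₂) → cong₂ _,_ (sym (cong proj₁ h₂)) (sym (cong proj₂ h₁)) }
    ; in-bij   = in-lift
    }
    where
    in-lift : ∀ y ε → tgt Down.Y ε ≡ πV y → ∃! _≡_ (λ ε′ → tgt Up.Y ε′ ≡ y × πE ε′ ≡ ε)
    in-lift (x , a) (e , c) h with cong proj₁ h
    ... | refl = (e , lifted) , (cong (t X e ,_) (Up.lift-+ₘ e a) , cong (e ,_) π-lifted) , unique
      where
      lifted = ℤMod.translate m′ (- Up.b e) a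
      π-lifted : π lifted ≡ c
      π-lifted = ℤMod.⟦⟧-injective m (begin
        ⟦ π lifted ⟧              ≈⟨ ⟦π⟧ lifted ⟩
        ⟦ lifted ⟧                ≈⟨ ≡-mod-weaken m∣m′ (ℤMod.⟦translate⟧ m′ (- Up.b e) a) ⟩
        ⟦ a ⟧ - ⟦ β′ e ⟧          ≈⟨ -‿cong-mod (⟦π⟧ a) (≡-mod-sym (β′≡β e)) ⟨
        ⟦ π a ⟧ - ⟦ β e ⟧         ≡⟨ cong (λ z → ⟦ z ⟧ - ⟦ β e ⟧) (cong proj₂ h) ⟨
        ⟦ c +ₘ β e ⟧ - ⟦ β e ⟧    ≈⟨ -‿congʳ-mod ⟦ β e ⟧ (⟦+ₘ⟧ c (β e)) ⟩
        ⟦ c ⟧ + ⟦ β e ⟧ - ⟦ β e ⟧ ≡⟨ [a+b]-b≡a ⟦ c ⟧ ⟦ β e ⟧ ⟩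
        ⟦ c ⟧                     ∎)
        where open ≡-mod-Reasoning m
      unique : ∀ {ε′} → tgt Up.Y ε′ ≡ (t X e , a) × πE ε′ ≡ (e , c) → (e , lifted) ≡ ε′
      unique {e₂ , a₂} (h₁ , h₂) with cong proj₁ h₂
      ... | refl = cong (e ,_) (trans (cong (ℤMod.translate m′ (- Up.b e)) (sym (cong proj₂ h₁))) (Up.+ₘ-lift e a₂))

-- The layers X_n

module Tower {p : ℕ} (pr : Prime p) (X : FinGraph) (α : Fin (nE X) → ℤₚ pr) where

  open ℤₚUnits pr

  private instance
    p≢0 : NonZero p
    p≢0 = prime⇒nonZero pr

  1<p : 1 ℕ.< p
  1<p = ℕ.nonTrivial⇒n>1 p {{prime⇒nonTrivial pr}}

  1<p¹ : 1 ℕ.< p ^ 1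
  1<p¹ = subst (1 ℕ.<_) (sym (ℕ.*-identityʳ p)) 1<p

  p²∤p : ¬ (+ (p ^ 2) ∣ + p)
  p²∤p p²∣p = ℕ.<⇒≱ (ℕ.m<m*n p (p ^ 1) 1<p¹) (ℕ.∣⇒≤ (∣⇒∣ᵤ p²∣p))

  βₙ : ∀ n → Fin (nE X) → Fin (p ^ n)
  βₙ n e = red pr (α e) n

  ⟦βₙ⟧ : ∀ n e → ⟦ βₙ n e ⟧ ≡ + digit (α e) n
  ⟦βₙ⟧ n e = cong +_ (Fin.toℕ-fromℕ< (digit< (α e) n))

  layer-covering : ∀ n → IsCovering (Layer pr X α (suc n)) (Layer pr X α n)
                                    (λ { (x , a) → (x , down pr n a) }) (λ { (e , a) → (e , down pr n a) })
  layer-covering n = Reduction.covering X (pⁿ∣pⁿ⁺¹ n) (βₙ (suc n)) (βₙ n) βₙ-coherent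
    where
    instance
      pⁿ≢0 : NonZero (p ^ n)
      pⁿ≢0 = m^n≢0 p n
      pⁿ⁺¹≢0 : NonZero (p ^ suc n)
      pⁿ⁺¹≢0 = m^n≢0 p (suc n)
    βₙ-coherent : ∀ e → ⟦ βₙ (suc n) e ⟧ ≡ ⟦ βₙ n e ⟧ mod p ^ n
    βₙ-coherent e = begin
      ⟦ βₙ (suc n) e ⟧      ≡⟨ ⟦βₙ⟧ (suc n) e ⟩
      + digit (α e) (suc n) ≈⟨ digit-coherent n (α e) ⟩
      + digit (α e) n       ≡⟨ ⟦βₙ⟧ n e ⟨
      ⟦ βₙ n e ⟧            ∎
      where open ≡-mod-Reasoning (p ^ n)

  module _ (constant : IsConstant pr {X} α) where

    ⟦βₙ⟧-constant : ∀ n e₀ e → ⟦ βₙ n e ⟧ ≡ + digit (α e₀) n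
    ⟦βₙ⟧-constant n e₀ e = trans (⟦βₙ⟧ n e) (cong +_ (constant e e₀ n))

    sufficiency : Connected X → (∀ e → IsUnit pr (α e)) → Σ (DirCycle X) (λ c → Coprime ∣ cycleWeight c ∣ p) →
                  IsZpTower pr X α
    sufficiency connected units (c , c⊥p) n =
      layer-covering n ,
      (covering , fibre , translation , every-deck-is-translation connected W W-invertible , translation-injective v) ,
      (translation , (every-deck-is-translation connected W W-invertible , translation-injective v) , translation-+ₘ)
      where
      instance
        pⁿ≢0 : NonZero (p ^ n)
        pⁿ≢0 = m^n≢0 p n
      open DerivedGraph X (βₙ n)
      open Walks X
      open Cycles X
      e₀ = proj₁ (dart c fzero)
      v = dsrc X (dart c fzero)
      W = cycleWalk c
      W-invertible : InvertibleMod (p ^ n) (voltage b W)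
      W-invertible = subst (InvertibleMod (p ^ n)) (sym voltage≡)
        (invertible-* {y = cycleWeight c} (coprime-∣∣⇒invertible {z = cycleWeight c} (coprime-^ c⊥p n))
                                          (IsUnit⇒invertible n {α e₀} (units e₀)))
        where
        voltage≡ : voltage b W ≡ cycleWeight c * + digit (α e₀) n
        voltage≡ = trans (voltage-constant (⟦βₙ⟧-constant n e₀) W) (cong (_* + digit (α e₀) n) (weight-cycleWalk c))

    module Necessity (connected : Connected X) (tower : IsZpTower pr X α) where

      private instance
        p¹≢0 : NonZero (p ^ 1)
        p¹≢0 = m^n≢0 p 1
        p²≢0 : NonZero (p ^ 2)
        p²≢0 = m^n≢0 p 2

      order : ∀ n → DeckOrder {Layer pr X α n} {toGraph X} {proj₁} {proj₁} (p ^ n)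
      order n = proj₂ (proj₂ (proj₁ (proj₂ (tower n))))

      base : Fin (nV X)
      base = DerivedGraph.deckOrder⇒vertex X (βₙ 1) 1<p¹ (order 1)

      open DerivedGraph X (βₙ 2)
      open Walks X

      path : ∀ x → Walk base x
      path x = fromUWalk (connected base x)

      κ : Fin (nV X) → ℤ
      κ x = voltage b (path x)

      defect : Fin (nE X) → ℤ
      defect e = κ (s X e) + b e - κ (t X e)

      -- Translation by p is the identity of X_1, so the argument needs X_2.
      bad-edge : ∃ λ e → ¬ (+ p ∣ defect e)
      bad-edge = Fin.¬∀⟶∃¬ (nE X) (λ e → + p ∣ defect e) (λ e → + p ∣? defect e) λ p∣defect →
        deckOrder-excludes-potential 1<p (p∣pⁿ⁺¹ 1) p²∤p base (order 2) κ (λ e → mk (p∣defect e))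

      bad : Fin (nE X)
      bad = proj₁ bad-edge

      loop : Walk base base
      loop = edgeLoop bad (path (s X bad)) (path (t X bad))

      defect≡ : defect bad ≡ weight loop * + digit (α bad) 2
      defect≡ = voltage-edgeLoop (⟦βₙ⟧-constant 2 bad) bad (path (s X bad)) (path (t X bad))

      p∤digit : ¬ (p ℕ.∣ digit (α bad) 2)
      p∤digit p∣digit = proj₂ bad-edge (subst (+ p ∣_) (sym defect≡) (∣n⇒∣m*n (weight loop) (∣ᵤ⇒∣ p∣digit)))

      p∤loop : ¬ (+ p ∣ weight loop)
      p∤loop p∣loop = proj₂ bad-edge (subst (+ p ∣_) (sym defect≡) (∣m⇒∣m*n (+ digit (α bad) 2) p∣loop))

      units : ∀ e → IsUnit pr (α e)
      units e = IsUnit-resp-≈ₚ {α bad} {α e} (¬p∣digit⇒IsUnit (α bad) {k = 1} p∤digit) (constant bad e)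

      cycle : Σ (DirCycle X) (λ c → Coprime ∣ cycleWeight c ∣ p)
      cycle = map₂ (λ {c} p∤c → prime∤⇒coprime {x = ∣ cycleWeight c ∣} pr (p∤c ∘ ∣ᵤ⇒∣))
                   (Cycles.closedWalk⇒cycle X p loop p∤loop)

    necessity : Connected X → IsZpTower pr X α →
                (∀ e → IsUnit pr (α e)) × Σ (DirCycle X) (λ c → Coprime ∣ cycleWeight c ∣ p)
    necessity connected tower = units , cycle
      where open Necessity connected tower

corollary3p6 : (p : ℕ) (pr : Prime p) (X : FinGraph) → Connected X →
    (α : Fin (nE X) → ℤₚ pr) → IsConstant pr {X} α →
    IsZpTower pr X α ⇔
      ((∀ e → IsUnit pr (α e)) × Σ (DirCycle X) (λ c → Coprime ∣ cycleWeight c ∣ p))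
corollary3p6 p pr X connected α constant =
  mk⇔ (necessity constant connected) (uncurry (sufficiency constant connected))
  where open Tower pr X α
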